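{- Let $\mathsf{Eq}$ be a set of equations containing the set $\mathsf{DN}$ of equations axiomatizing distributive lattices with negation, and let $\mathbb{V}_{\mathsf{Eq}}$ be the variety axiomatized by $\mathsf{Eq}$. Then $\vdash_{\mathcal{R}^{\mathsf{Eq}}_\omega\cup\mathcal{R}_{\mathsf{F}}}\;=\;\vdash^{\leq}_{\mathbb{V}_{\mathsf{Eq}}}$.
   Context: Language: binary $\land,\lor$, unary $\neg$, constants $\bot,\top$; $Fm$ is the set of formulas over a countably infinite set of variables; an equation is a pair $\varphi\approx\psi$ of formulas. $\mathsf{DN}$ is the set of equations: $x\lor y\approx y\lor x$, $x\land y\approx y\land x$, $x\lor(y\lor z)\approx(x\lor y)\lor z$, $x\land(y\land z)\approx(x\land y)\land z$, $x\lor x\approx x$, $x\land x\approx x$, $x\lor(x\land y)\approx x$, $x\land(x\lor y)\approx x$, $x\land\bot\approx\bot$, $x\lor\top\approx\top$, $x\land(y\lor z)\approx(x\land y)\lor(x\land z)$, $\neg\bot\approx\top$, $\neg(x\lor y)\approx\neg x\land\neg y$. For a class $\mathbb{K}$ of algebras of this type with bounded lattice reducts, $\Gamma\vdash^{\leq}_{\mathbb{K}}\varphi$ iff for every $\mathbf{A}\in\mathbb{K}$, every non-empty lattice filter $F$ of $\mathbf{A}$ and every homomorphism $h\colon Fm\to A$, $h[\Gamma]\subseteq F$ implies $h(\varphi)\in F$. A rule is a pair $\frac{\Gamma}{\varphi}$ with $\Gamma$ a finite set of formulas; $\vdash_{\mathcal{R}}$ denotes derivability by Hilbert derivations using substitution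 instances of rules in $\mathcal{R}$. For a set $\mathsf{Eq}$ of equations, $\mathcal{R}^{\mathsf{Eq}}=\{\frac{\varphi}{\psi},\frac{\psi}{\varphi}:\varphi\approx\psi\in\mathsf{Eq}\}$. For a set $\mathcal{R}$ of single-premise rules, fix fresh variables $q_0,q_1,\dots$ not occurring in $\mathcal{R}$ and set $\mathcal{R}_0=\mathcal{R}$, $\mathcal{R}_{n+1}=\{\frac{\varphi\lor q_n}{\psi\lor q_n},\frac{\varphi\land q_n}{\psi\land q_n},\frac{\neg\psi}{\neg\varphi}:\frac{\varphi}{\psi}\in\mathcal{R}_n\}$, $\mathcal{R}_\omega=\bigcup_{n<\omega}\mathcal{R}_n$; $\mathcal{R}^{\mathsf{Eq}}_\omega$ denotes $(\mathcal{R}^{\mathsf{Eq}})_\omega$. Finally $\mathcal{R}_{\mathsf{F}}=\{\frac{}{\top},\frac{p\,,\,q}{p\land q},\frac{p}{p\lor q}\}$. -}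

module Defs where

open import Data.Nat using (ℕ; zero; suc)
open import Data.Product using (Σ; ∃; _×_; _,_)
open import Data.Sum using (_⊎_)
open import Data.List using (List; []; _∷_)
open import Data.Empty using (⊥)
open import Relation.Unary using (Pred)
open import Relation.Binary.PropositionalEquality using (_≡_)
open import Relation.Binary.Structures using (IsEquivalence)
open import Function.Definitions using (Injective)
import Data.List.Membership.Propositional as LM

infixr 6 _∧ᶠ_
infixr 5 _∨ᶠ_

data Fm : Set where
  var   : ℕ → Fm
  _∧ᶠ_  : Fm → Fm → Fm
  _∨ᶠ_  : Fm → Fm → Fm
  ¬ᶠ_   : Fm → Fm
  ⊥ᶠ    : Fm
  ⊤ᶠ    : Fm

Equation : Set
Equation = Fm × Fm

sub : (ℕ → Fm) → Fm → Fm
sub σ (var x)   = σ x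
sub σ (φ ∧ᶠ ψ)  = sub σ φ ∧ᶠ sub σ ψ
sub σ (φ ∨ᶠ ψ)  = sub σ φ ∨ᶠ sub σ ψ
sub σ (¬ᶠ φ)    = ¬ᶠ sub σ φ
sub σ ⊥ᶠ        = ⊥ᶠ
sub σ ⊤ᶠ        = ⊤ᶠ

data Occurs (x : ℕ) : Fm → Set where
  here : Occurs x (var x)
  ∧ˡ   : ∀ {φ ψ} → Occurs x φ → Occurs x (φ ∧ᶠ ψ)
  ∧ʳ   : ∀ {φ ψ} → Occurs x ψ → Occurs x (φ ∧ᶠ ψ)
  ∨ˡ   : ∀ {φ ψ} → Occurs x φ → Occurs x (φ ∨ᶠ ψ)
  ∨ʳ   : ∀ {φ ψ} → Occurs x ψ → Occurs x (φ ∨ᶠ ψ)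
  ¬o   : ∀ {φ} → Occurs x φ → Occurs x (¬ᶠ φ)

private
  x y z : Fm
  x = var 0
  y = var 1
  z = var 2

data DN : Pred Equation Agda.Primitive.lzero where
  ∨-comm   : DN (x ∨ᶠ y , y ∨ᶠ x)
  ∧-comm   : DN (x ∧ᶠ y , y ∧ᶠ x)
  ∨-assoc  : DN (x ∨ᶠ (y ∨ᶠ z) , (x ∨ᶠ y) ∨ᶠ z)
  ∧-assoc  : DN (x ∧ᶠ (y ∧ᶠ z) , (x ∧ᶠ y) ∧ᶠ z)
  ∨-idem   : DN (x ∨ᶠ x , x)
  ∧-idem   : DN (x ∧ᶠ x , x)
  ∨-abs    : DN (x ∨ᶠ (x ∧ᶠ y) , x)
  ∧-abs    : DN (x ∧ᶠ (x ∨ᶠ y) , x)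
  ∧-bot    : DN (x ∧ᶠ ⊥ᶠ , ⊥ᶠ)
  ∨-top    : DN (x ∨ᶠ ⊤ᶠ , ⊤ᶠ)
  distrib  : DN (x ∧ᶠ (y ∨ᶠ z) , (x ∧ᶠ y) ∨ᶠ (x ∧ᶠ z))
  ¬-bot    : DN (¬ᶠ ⊥ᶠ , ⊤ᶠ)
  ¬-∨      : DN (¬ᶠ (x ∨ᶠ y) , ¬ᶠ x ∧ᶠ ¬ᶠ y)

Rule : Set
Rule = List Fm × Fm

SRule : Set
SRule = Fm × Fm

single : SRule → Rule
single (φ , ψ) = (φ ∷ [] , ψ)

data Derivable (R : Pred Rule Agda.Primitive.lzero) (Γ : Pred Fm Agda.Primitive.lzero) : Fm → Set where
  hyp : ∀ {φ} → Γ φ → Derivable R Γ φ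
  app : (prem : List Fm) (concl : Fm) → R (prem , concl) → (σ : ℕ → Fm) →
        (∀ ψ → ψ LM.∈ prem → Derivable R Γ (sub σ ψ)) →
        Derivable R Γ (sub σ concl)

data REq (Eq : Pred Equation Agda.Primitive.lzero) : Pred SRule Agda.Primitive.lzero where
  fwd : ∀ {φ ψ} → Eq (φ , ψ) → REq Eq (φ , ψ)
  bwd : ∀ {φ ψ} → Eq (φ , ψ) → REq Eq (ψ , φ)

-- R_n, with fresh variables q 0, q 1, …
data Rn (q : ℕ → ℕ) (R : Pred SRule Agda.Primitive.lzero) : ℕ → SRule → Set where
  base : ∀ {r} → R r → Rn q R 0 r
  ∨q   : ∀ {n φ ψ} → Rn q R n (φ , ψ) → Rn q R (suc n) (φ ∨ᶠ var (q n) , ψ ∨ᶠ var (q n))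
  ∧q   : ∀ {n φ ψ} → Rn q R n (φ , ψ) → Rn q R (suc n) (φ ∧ᶠ var (q n) , ψ ∧ᶠ var (q n))
  ¬r   : ∀ {n φ ψ} → Rn q R n (φ , ψ) → Rn q R (suc n) (¬ᶠ ψ , ¬ᶠ φ)

Rω : (ℕ → ℕ) → Pred SRule Agda.Primitive.lzero → Pred SRule Agda.Primitive.lzero
Rω q R r = ∃ λ n → Rn q R n r

asRules : Pred SRule Agda.Primitive.lzero → Pred Rule Agda.Primitive.lzero
asRules R r = Σ SRule λ s → R s × (single s ≡ r)

data RF : Pred Rule Agda.Primitive.lzero where
  top-r : RF ([] , ⊤ᶠ)
  and-r : RF (var 0 ∷ var 1 ∷ [] , var 0 ∧ᶠ var 1)
  or-r  : RF (var 0 ∷ [] , var 0 ∨ᶠ var 1)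

_∪R_ : Pred Rule Agda.Primitive.lzero → Pred Rule Agda.Primitive.lzero → Pred Rule Agda.Primitive.lzero
(R ∪R S) r = R r ⊎ S r

-- Algebras (setoid-based, since quotients are not available)

record Algebra : Set₁ where
  field
    Carrier : Set
    _≈_     : Carrier → Carrier → Set
    isEquivalence : IsEquivalence _≈_
    _∧_ _∨_ : Carrier → Carrier → Carrier
    ¬_      : Carrier → Carrier
    ⊥ₐ ⊤ₐ   : Carrier
    ∧-cong  : ∀ {a a' b b'} → a ≈ a' → b ≈ b' → (a ∧ b) ≈ (a' ∧ b')
    ∨-cong  : ∀ {a a' b b'} → a ≈ a' → b ≈ b' → (a ∨ b) ≈ (a' ∨ b')
    ¬-cong  : ∀ {a a'} → a ≈ a' → (¬ a) ≈ (¬ a')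

module _ (A : Algebra) where
  open Algebra A

  eval : (ℕ → Carrier) → Fm → Carrier
  eval v (var i)  = v i
  eval v (φ ∧ᶠ ψ) = eval v φ ∧ eval v ψ
  eval v (φ ∨ᶠ ψ) = eval v φ ∨ eval v ψ
  eval v (¬ᶠ φ)   = ¬ eval v φ
  eval v ⊥ᶠ       = ⊥ₐ
  eval v ⊤ᶠ       = ⊤ₐ

  Satisfies : Equation → Set
  Satisfies (φ , ψ) = ∀ (v : ℕ → Carrier) → eval v φ ≈ eval v ψ

  record IsHom (h : Fm → Carrier) : Set where
    field
      hom-∧ : ∀ φ ψ → h (φ ∧ᶠ ψ) ≈ (h φ ∧ h ψ)
      hom-∨ : ∀ φ ψ → h (φ ∨ᶠ ψ) ≈ (h φ ∨ h ψ)
      hom-¬ : ∀ φ → h (¬ᶠ φ) ≈ (¬ h φ)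
      hom-⊥ : h ⊥ᶠ ≈ ⊥ₐ
      hom-⊤ : h ⊤ᶠ ≈ ⊤ₐ

  _≤ₐ_ : Carrier → Carrier → Set
  a ≤ₐ b = (a ∧ b) ≈ a

  record IsFilter (F : Pred Carrier Agda.Primitive.lzero) : Set where
    field
      nonempty : ∃ λ a → F a
      up-closed : ∀ {a b} → F a → a ≤ₐ b → F b
      ∧-closed : ∀ {a b} → F a → F b → F (a ∧ b)

InVariety : Pred Equation Agda.Primitive.lzero → Algebra → Set
InVariety Eq A = ∀ e → Eq e → Satisfies A e

SemCons : Pred Equation Agda.Primitive.lzero → Pred Fm Agda.Primitive.lzero → Fm → Set₁
SemCons Eq Γ φ =
  (A : Algebra) → InVariety Eq A →
  (F : Pred (Algebra.Carrier A) Agda.Primitive.lzero) → IsFilter A F →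
  (h : Fm → Algebra.Carrier A) → IsHom A h →
  (∀ ψ → Γ ψ → F (h ψ)) → F (h φ)

FreshFor : (ℕ → ℕ) → Pred Equation Agda.Primitive.lzero → Set
FreshFor q Eq = Injective _≡_ _≡_ q ×
  (∀ n φ ψ → Eq (φ , ψ) → (Occurs (q n) φ → ⊥) × (Occurs (q n) ψ → ⊥))

-- Soundness: each rule of R^Eq_ω relates two formulas equal in every algebra of V_Eq (the
-- contexts ∨ q, ∧ q and ¬ preserve equality), and lattice filters are closed under ≈ and
-- under the rules of R_F.
-- Completeness: let a ≃ b mean that a rewrites to b by finitely many substitution instances of
-- rules of R^Eq_ω. The rules in R_n avoid q n, so substituting χ for q n in the rule of R_(n+1)
-- built from one of R_n lifts a step a ⟶ b to a ∧ χ ⟶ b ∧ χ and a ∨ χ ⟶ b ∨ χ; with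
-- commutativity this makes ≃ a congruence, and formulas modulo ≃ form an algebra of V_Eq in
-- which the formulas derivable from Γ form a filter. Semantic consequence, applied there to the
-- identity homomorphism, yields derivability.
module Submission where

open import Defs
open import Agda.Primitive using (lzero)
open import Data.Empty using (⊥-elim)
open import Data.List using ([]; _∷_)
open import Data.List.Relation.Unary.Any using (here; there)
open import Data.Nat using (ℕ; suc; _≤_; _<_; _≟_)
open import Data.Nat.Properties using (≤-refl; <⇒≤; <⇒≢)
open import Data.Product using (_×_; _,_; proj₁; proj₂; map; swap)
open import Data.Sum using (inj₁; inj₂)
open import Relation.Binary.Construct.Closure.ReflexiveTransitive
  using (Star; ε; _◅_; _◅◅_; gmap; reverse)
open import Relation.Binary.PropositionalEquality using (_≡_; _≢_; refl; sym; cong; cong₂)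
open import Relation.Binary.Structures using (IsEquivalence)
open import Relation.Nullary using (¬_; yes; no)
open import Relation.Unary using (Pred; _⊆_)

⟨_,_⟩ : {C : Set} → C → C → ℕ → C
⟨ a , b ⟩ 0       = a
⟨ a , b ⟩ (suc _) = b

REq-sym : ∀ {Eq α β} → REq Eq (α , β) → REq Eq (β , α)
REq-sym (fwd e) = bwd e
REq-sym (bwd e) = fwd e

Rn-sym : ∀ {q R n α β} → (∀ {α β} → R (α , β) → R (β , α)) →
         Rn q R n (α , β) → Rn q R n (β , α)
Rn-sym R-sym (base r) = base (R-sym r)
Rn-sym R-sym (∨q r)   = ∨q (Rn-sym R-sym r)
Rn-sym R-sym (∧q r)   = ∧q (Rn-sym R-sym r)
Rn-sym R-sym (¬r r)   = ¬r (Rn-sym R-sym r)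

module _ {x : ℕ} where

  ¬occurs-var : ∀ {y} → x ≢ y → ¬ Occurs x (var y)
  ¬occurs-var x≢y here = x≢y refl

  ¬occurs-∧ : ∀ {α β} → ¬ Occurs x α → ¬ Occurs x β → ¬ Occurs x (α ∧ᶠ β)
  ¬occurs-∧ ¬α ¬β (∧ˡ o) = ¬α o
  ¬occurs-∧ ¬α ¬β (∧ʳ o) = ¬β o

  ¬occurs-∨ : ∀ {α β} → ¬ Occurs x α → ¬ Occurs x β → ¬ Occurs x (α ∨ᶠ β)
  ¬occurs-∨ ¬α ¬β (∨ˡ o) = ¬α o
  ¬occurs-∨ ¬α ¬β (∨ʳ o) = ¬β o

  ¬occurs-¬ : ∀ {α} → ¬ Occurs x α → ¬ Occurs x (¬ᶠ α)
  ¬occurs-¬ ¬α (¬o o) = ¬α o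

update : (ℕ → Fm) → ℕ → Fm → ℕ → Fm
update σ x χ y with y ≟ x
... | yes _ = χ
... | no  _ = σ y

update-same : ∀ σ x χ → update σ x χ x ≡ χ
update-same σ x χ with x ≟ x
... | yes _  = refl
... | no x≢x = ⊥-elim (x≢x refl)

sub-update-¬occurs : ∀ σ x χ α → ¬ Occurs x α → sub (update σ x χ) α ≡ sub σ α
sub-update-¬occurs σ x χ (var y) x∉ with y ≟ x
... | yes refl = ⊥-elim (x∉ here)
... | no  _    = refl
sub-update-¬occurs σ x χ (α ∧ᶠ β) x∉ =
  cong₂ _∧ᶠ_ (sub-update-¬occurs σ x χ α (λ o → x∉ (∧ˡ o)))
             (sub-update-¬occurs σ x χ β (λ o → x∉ (∧ʳ o)))
sub-update-¬occurs σ x χ (α ∨ᶠ β) x∉ =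
  cong₂ _∨ᶠ_ (sub-update-¬occurs σ x χ α (λ o → x∉ (∨ˡ o)))
             (sub-update-¬occurs σ x χ β (λ o → x∉ (∨ʳ o)))
sub-update-¬occurs σ x χ (¬ᶠ α) x∉ = cong ¬ᶠ_ (sub-update-¬occurs σ x χ α (λ o → x∉ (¬o o)))
sub-update-¬occurs σ x χ ⊥ᶠ _ = refl
sub-update-¬occurs σ x χ ⊤ᶠ _ = refl

module _ {Eq : Pred Equation lzero} {q : ℕ → ℕ} (fresh : FreshFor q Eq) where

  q-¬occurs-q : ∀ {n m} → n < m → ¬ Occurs (q m) (var (q n))
  q-¬occurs-q n<m = ¬occurs-var (λ qm≡qn → <⇒≢ n<m (sym (proj₁ fresh qm≡qn)))

  Rn-fresh : ∀ {n m α β} → Rn q (REq Eq) n (α , β) → n ≤ m →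
             ¬ Occurs (q m) α × ¬ Occurs (q m) β
  Rn-fresh (base (fwd e)) _ = proj₂ fresh _ _ _ e
  Rn-fresh (base (bwd e)) _ = swap (proj₂ fresh _ _ _ e)
  Rn-fresh (∨q r) n<m =
    map (λ x∉ → ¬occurs-∨ x∉ (q-¬occurs-q n<m)) (λ x∉ → ¬occurs-∨ x∉ (q-¬occurs-q n<m))
        (Rn-fresh r (<⇒≤ n<m))
  Rn-fresh (∧q r) n<m =
    map (λ x∉ → ¬occurs-∧ x∉ (q-¬occurs-q n<m)) (λ x∉ → ¬occurs-∧ x∉ (q-¬occurs-q n<m))
        (Rn-fresh r (<⇒≤ n<m))
  Rn-fresh (¬r r) n<m = swap (map ¬occurs-¬ ¬occurs-¬ (Rn-fresh r (<⇒≤ n<m)))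

HilbertRules : Pred Equation lzero → (ℕ → ℕ) → Pred Rule lzero
HilbertRules Eq q = asRules (Rω q (REq Eq)) ∪R RF

module Soundness {Eq : Pred Equation lzero} (DN⊆Eq : DN ⊆ Eq) (q : ℕ → ℕ)
                 (A : Algebra) (A∈V : InVariety Eq A) where
  open Algebra A
  open IsEquivalence isEquivalence renaming (refl to ≈-refl; sym to ≈-sym; trans to ≈-trans)

  DN-valid : ∀ {α β} → DN (α , β) → Satisfies A (α , β)
  DN-valid d = A∈V _ (DN⊆Eq d)

  Rn-valid : ∀ {n α β} → Rn q (REq Eq) n (α , β) → Satisfies A (α , β)
  Rn-valid (base (fwd e)) v = A∈V _ e v
  Rn-valid (base (bwd e)) v = ≈-sym (A∈V _ e v)
  Rn-valid (∨q r) v = ∨-cong (Rn-valid r v) ≈-refl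
  Rn-valid (∧q r) v = ∧-cong (Rn-valid r v) ≈-refl
  Rn-valid (¬r r) v = ¬-cong (≈-sym (Rn-valid r v))

  module _ {h : Fm → Carrier} (isHom : IsHom A h) where
    open IsHom isHom

    hom-sub : ∀ σ φ → h (sub σ φ) ≈ eval A (λ i → h (σ i)) φ
    hom-sub σ (var x)  = ≈-refl
    hom-sub σ (φ ∧ᶠ ψ) = ≈-trans (hom-∧ _ _) (∧-cong (hom-sub σ φ) (hom-sub σ ψ))
    hom-sub σ (φ ∨ᶠ ψ) = ≈-trans (hom-∨ _ _) (∨-cong (hom-sub σ φ) (hom-sub σ ψ))
    hom-sub σ (¬ᶠ φ)   = ≈-trans (hom-¬ _) (¬-cong (hom-sub σ φ))
    hom-sub σ ⊥ᶠ       = hom-⊥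
    hom-sub σ ⊤ᶠ       = hom-⊤

  module FilterProperties {F : Pred Carrier lzero} (isFilter : IsFilter A F) where
    open IsFilter isFilter

    ∈F-resp-≈ : ∀ {a b} → F a → a ≈ b → F b
    ∈F-resp-≈ {a} a∈F a≈b = up-closed a∈F (≈-trans (∧-cong ≈-refl (≈-sym a≈b)) (DN-valid ∧-idem ⟨ a , a ⟩))

    ∨-∈F : ∀ {a} b → F a → F (a ∨ b)
    ∨-∈F {a} b a∈F = up-closed a∈F (DN-valid ∧-abs ⟨ a , b ⟩)

    ⊤-∈F : F ⊤ₐ
    ⊤-∈F with nonempty
    ... | a , a∈F = ∈F-resp-≈ (∨-∈F ⊤ₐ a∈F) (DN-valid ∨-top ⟨ a , a ⟩)

  module _ {h : Fm → Carrier} (isHom : IsHom A h)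
           {F : Pred Carrier lzero} (isFilter : IsFilter A F) where
    open IsHom isHom
    open IsFilter isFilter
    open FilterProperties isFilter

    sound : ∀ {Γ φ} → (∀ ψ → Γ ψ → F (h ψ)) → Derivable (HilbertRules Eq q) Γ φ → F (h φ)
    sound h[Γ]⊆F (hyp γ) = h[Γ]⊆F _ γ
    sound h[Γ]⊆F (app _ _ (inj₁ ((α , β) , (n , r) , refl)) σ ⊢prem) =
      ∈F-resp-≈ (sound h[Γ]⊆F (⊢prem α (here refl)))
        (≈-trans (hom-sub isHom σ α) (≈-trans (Rn-valid r _) (≈-sym (hom-sub isHom σ β))))
    sound h[Γ]⊆F (app _ _ (inj₂ top-r) σ ⊢prem) = ∈F-resp-≈ ⊤-∈F (≈-sym hom-⊤)
    sound h[Γ]⊆F (app _ _ (inj₂ and-r) σ ⊢prem) =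
      ∈F-resp-≈ (∧-closed (sound h[Γ]⊆F (⊢prem (var 0) (here refl)))
                          (sound h[Γ]⊆F (⊢prem (var 1) (there (here refl)))))
                (≈-sym (hom-∧ _ _))
    sound h[Γ]⊆F (app _ _ (inj₂ or-r) σ ⊢prem) =
      ∈F-resp-≈ (∨-∈F (h (σ 1)) (sound h[Γ]⊆F (⊢prem (var 0) (here refl))))
                (≈-sym (hom-∨ _ _))

module Completeness {Eq : Pred Equation lzero} (DN⊆Eq : DN ⊆ Eq)
                    {q : ℕ → ℕ} (fresh : FreshFor q Eq) where

  infix 4 _⟶_ _≃_

  data _⟶_ : Fm → Fm → Set where
    instance-of : ∀ {n α β} → Rn q (REq Eq) n (α , β) → (σ : ℕ → Fm) → sub σ α ⟶ sub σ β

  instance-of-≡ : ∀ {n α β a b} → Rn q (REq Eq) n (α , β) → (σ : ℕ → Fm) →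
                  sub σ α ≡ a → sub σ β ≡ b → a ⟶ b
  instance-of-≡ r σ refl refl = instance-of r σ

  DN-step : ∀ {α β} → DN (α , β) → (σ : ℕ → Fm) → sub σ α ⟶ sub σ β
  DN-step d = instance-of (base (fwd (DN⊆Eq d)))

  ⟶-sym : ∀ {a b} → a ⟶ b → b ⟶ a
  ⟶-sym (instance-of r σ) = instance-of (Rn-sym REq-sym r) σ

  ⟶-¬ : ∀ {a b} → a ⟶ b → ¬ᶠ a ⟶ ¬ᶠ b
  ⟶-¬ (instance-of r σ) = instance-of (¬r (Rn-sym REq-sym r)) σ

  sub-update-q : ∀ {n α β} → Rn q (REq Eq) n (α , β) → ∀ σ χ →
                 sub (update σ (q n) χ) α ≡ sub σ α × sub (update σ (q n) χ) β ≡ sub σ β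
  sub-update-q r σ χ =
    map (sub-update-¬occurs σ _ χ _) (sub-update-¬occurs σ _ χ _) (Rn-fresh fresh r ≤-refl)

  ⟶-∧ʳ : ∀ χ {a b} → a ⟶ b → a ∧ᶠ χ ⟶ b ∧ᶠ χ
  ⟶-∧ʳ χ (instance-of {n} r σ) with sub-update-q r σ χ
  ... | α-fixed , β-fixed = instance-of-≡ (∧q r) (update σ (q n) χ)
    (cong₂ _∧ᶠ_ α-fixed (update-same σ (q n) χ)) (cong₂ _∧ᶠ_ β-fixed (update-same σ (q n) χ))

  ⟶-∨ʳ : ∀ χ {a b} → a ⟶ b → a ∨ᶠ χ ⟶ b ∨ᶠ χ
  ⟶-∨ʳ χ (instance-of {n} r σ) with sub-update-q r σ χ
  ... | α-fixed , β-fixed = instance-of-≡ (∨q r) (update σ (q n) χ)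
    (cong₂ _∨ᶠ_ α-fixed (update-same σ (q n) χ)) (cong₂ _∨ᶠ_ β-fixed (update-same σ (q n) χ))

  _≃_ : Fm → Fm → Set
  _≃_ = Star _⟶_

  ≃-sym : ∀ {a b} → a ≃ b → b ≃ a
  ≃-sym = reverse ⟶-sym

  ≃-∧ : ∀ {a a' b b'} → a ≃ a' → b ≃ b' → a ∧ᶠ b ≃ a' ∧ᶠ b'
  ≃-∧ {a' = a'} {b} {b'} a≃a' b≃b' =
    gmap (_∧ᶠ b) (⟶-∧ʳ b) a≃a' ◅◅ DN-step ∧-comm ⟨ a' , b ⟩ ◅
    gmap (_∧ᶠ a') (⟶-∧ʳ a') b≃b' ◅◅ DN-step ∧-comm ⟨ b' , a' ⟩ ◅ ε

  ≃-∨ : ∀ {a a' b b'} → a ≃ a' → b ≃ b' → a ∨ᶠ b ≃ a' ∨ᶠ b'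
  ≃-∨ {a' = a'} {b} {b'} a≃a' b≃b' =
    gmap (_∨ᶠ b) (⟶-∨ʳ b) a≃a' ◅◅ DN-step ∨-comm ⟨ a' , b ⟩ ◅
    gmap (_∨ᶠ a') (⟶-∨ʳ a') b≃b' ◅◅ DN-step ∨-comm ⟨ b' , a' ⟩ ◅ ε

  Fm/≃ : Algebra
  Fm/≃ = record
    { Carrier       = Fm
    ; _≈_           = _≃_
    ; isEquivalence = record { refl = ε ; sym = ≃-sym ; trans = _◅◅_ }
    ; _∧_ = _∧ᶠ_ ; _∨_ = _∨ᶠ_ ; ¬_ = ¬ᶠ_ ; ⊥ₐ = ⊥ᶠ ; ⊤ₐ = ⊤ᶠ
    ; ∧-cong = ≃-∧ ; ∨-cong = ≃-∨ ; ¬-cong = gmap ¬ᶠ_ ⟶-¬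
    }

  eval-Fm/≃ : ∀ v φ → eval Fm/≃ v φ ≡ sub v φ
  eval-Fm/≃ v (var x)  = refl
  eval-Fm/≃ v (φ ∧ᶠ ψ) = cong₂ _∧ᶠ_ (eval-Fm/≃ v φ) (eval-Fm/≃ v ψ)
  eval-Fm/≃ v (φ ∨ᶠ ψ) = cong₂ _∨ᶠ_ (eval-Fm/≃ v φ) (eval-Fm/≃ v ψ)
  eval-Fm/≃ v (¬ᶠ φ)   = cong ¬ᶠ_ (eval-Fm/≃ v φ)
  eval-Fm/≃ v ⊥ᶠ       = refl
  eval-Fm/≃ v ⊤ᶠ       = refl

  Fm/≃∈V : InVariety Eq Fm/≃
  Fm/≃∈V (φ , ψ) e v =
    instance-of-≡ (base (fwd e)) v (sym (eval-Fm/≃ v φ)) (sym (eval-Fm/≃ v ψ)) ◅ ε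

  id-isHom : IsHom Fm/≃ (λ φ → φ)
  id-isHom = record { hom-∧ = λ _ _ → ε ; hom-∨ = λ _ _ → ε ; hom-¬ = λ _ → ε ; hom-⊥ = ε ; hom-⊤ = ε }

  module _ (Γ : Pred Fm lzero) where

    Theorems : Pred Fm lzero
    Theorems = Derivable (HilbertRules Eq q) Γ

    derive-⟶ : ∀ {a b} → a ⟶ b → Theorems a → Theorems b
    derive-⟶ (instance-of {n} {α} {β} r σ) ⊢a =
      app (α ∷ []) β (inj₁ ((α , β) , (n , r) , refl)) σ λ { _ (here refl) → ⊢a }

    derive-≃ : ∀ {a b} → a ≃ b → Theorems a → Theorems b
    derive-≃ ε         ⊢a = ⊢a
    derive-≃ (s ◅ a≃b) ⊢a = derive-≃ a≃b (derive-⟶ s ⊢a)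

    derive-⊤ : Theorems ⊤ᶠ
    derive-⊤ = app [] ⊤ᶠ (inj₂ top-r) (λ _ → ⊤ᶠ) λ _ ()

    derive-∧ : ∀ {a b} → Theorems a → Theorems b → Theorems (a ∧ᶠ b)
    derive-∧ {a} {b} ⊢a ⊢b = app _ _ (inj₂ and-r) ⟨ a , b ⟩
      λ { _ (here refl) → ⊢a ; _ (there (here refl)) → ⊢b }

    derive-∨ : ∀ {a} b → Theorems a → Theorems (a ∨ᶠ b)
    derive-∨ {a} b ⊢a = app _ _ (inj₂ or-r) ⟨ a , b ⟩ λ { _ (here refl) → ⊢a }

    Theorems-isFilter : IsFilter Fm/≃ Theorems
    Theorems-isFilter = record
      { nonempty  = ⊤ᶠ , derive-⊤
      ; up-closed = λ {a} {b} ⊢a a∧b≃a →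
          derive-≃ (DN-step ∨-comm ⟨ b ∧ᶠ a , b ⟩ ◅ DN-step ∨-abs ⟨ b , a ⟩ ◅ ε)
            (derive-∨ b (derive-≃ (≃-sym a∧b≃a ◅◅ DN-step ∧-comm ⟨ a , b ⟩ ◅ ε) ⊢a))
      ; ∧-closed  = derive-∧
      }

    complete : ∀ φ → SemCons Eq Γ φ → Theorems φ
    complete φ Γ⊨φ = Γ⊨φ Fm/≃ Fm/≃∈V Theorems Theorems-isFilter (λ φ → φ) id-isHom (λ _ → hyp)

theorem3p3 : (Eq : Pred Equation lzero) → DN ⊆ Eq →
    (q : ℕ → ℕ) → FreshFor q Eq →
    (Γ : Pred Fm lzero) (φ : Fm) →
    ((Derivable (asRules (Rω q (REq Eq)) ∪R RF) Γ φ → SemCons Eq Γ φ) ×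
     (SemCons Eq Γ φ → Derivable (asRules (Rω q (REq Eq)) ∪R RF) Γ φ))
theorem3p3 Eq DN⊆Eq q fresh Γ φ =
  (λ ⊢φ A A∈V F isFilter h isHom h[Γ]⊆F → Soundness.sound DN⊆Eq q A A∈V isHom isFilter h[Γ]⊆F ⊢φ) ,
  Completeness.complete DN⊆Eq fresh Γ φ
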